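{- Let $G$ and $H$ be connected graphs, let $A \subseteq V(G)$ with $|A| \ge 2$, and let $B \subseteq \bigcup_{w \in V(G)} V(H_w)$. If $B$ contains at least one vertex of $\bigcup_{a\in A} V(H_a)$, then $A \cup B$ is not a mutual-visibility set of $G \odot H$.
   Context: All graphs are finite, simple, undirected and connected. For a graph $G$ and $X \subseteq V(G)$, two vertices $u,v$ are $X$-visible if there exists a shortest $(u,v)$-path $P$ in $G$ with $V(P)\cap X \subseteq \{u,v\}$. A set $X\subseteq V(G)$ is a mutual-visibility set of $G$ if every two vertices of $X$ are $X$-visible. The corona $G\odot H$ is obtained from one copy of $G$ and $|V(G)|$ copies of $H$, the copy associated with $v\in V(G)$ being denoted $H_v$, by joining each $v \in V(G)$ to every vertex of $H_v$. -}

module Defs where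

open import Level using (0ℓ)
open import Data.Nat using (ℕ; zero; suc; _<_)
open import Data.Fin using (Fin)
open import Data.Fin.Subset using (Subset; _∈_)
open import Data.Product using (Σ; ∃; _×_; _,_)
open import Data.Sum using (_⊎_; inj₁; inj₂)
open import Data.Empty using (⊥)
open import Data.Unit using (⊤)
open import Data.List using (List; []; _∷_)
open import Data.List.Relation.Unary.All using (All)
open import Relation.Nullary using (¬_)
open import Relation.Binary.PropositionalEquality using (_≡_)

record Graph (V : Set) : Set₁ where
  field
    Adj    : V → V → Set
    sym    : ∀ {u v} → Adj u v → Adj v u
    irrefl : ∀ {u} → ¬ Adj u u
open Graph public

module _ {V : Set} (G : Graph V) where

  data Walk : V → V → ℕ → Set where
    []  : ∀ {u} → Walk u u 0
    _∷_ : ∀ {u w v k} → Adj G u w → Walk w v k → Walk u v (suc k)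

  walkVertices : ∀ {u v k} → Walk u v k → List V
  walkVertices {u} []       = u ∷ []
  walkVertices {u} (_ ∷ p)  = u ∷ walkVertices p

  Connected : Set
  Connected = ∀ u v → ∃ λ k → Walk u v k

  -- A shortest (u,v)-path of length k: a (u,v)-walk of length k such that
  -- no (u,v)-walk is shorter (such a walk is automatically a path).
  IsShortest : ∀ {u v k} → Walk u v k → Set
  IsShortest {u} {v} {k} _ = ∀ {j} → Walk u v j → ¬ (j < k)

  Visible : (V → Set) → V → V → Set
  Visible X u v =
    Σ ℕ λ k → Σ (Walk u v k) λ P →
      IsShortest P × All (λ x → X x → (x ≡ u ⊎ x ≡ v)) (walkVertices P)

  IsMutualVisibilitySet : (V → Set) → Set
  IsMutualVisibilitySet X = ∀ u v → X u → X v → Visible X u v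

-- Corona G ⊙ H for G on Fin n and H on Fin m.
-- Vertices: inj₁ v  (v ∈ V(G)),  inj₂ (w , h)  (vertex h of the copy H_w).
CoronaV : ℕ → ℕ → Set
CoronaV n m = Fin n ⊎ (Fin n × Fin m)

CoronaAdj : ∀ {n m} → Graph (Fin n) → Graph (Fin m) → CoronaV n m → CoronaV n m → Set
CoronaAdj G H (inj₁ u)       (inj₁ v)       = Adj G u v
CoronaAdj G H (inj₁ u)       (inj₂ (w , h)) = u ≡ w
CoronaAdj G H (inj₂ (w , h)) (inj₁ u)       = w ≡ u
CoronaAdj G H (inj₂ (w , h)) (inj₂ (w' , h')) = (w ≡ w') × Adj H h h'

private
  open import Relation.Binary.PropositionalEquality using (refl) renaming (sym to ≡sym)

  coronaSym : ∀ {n m} (G : Graph (Fin n)) (H : Graph (Fin m)) {x y} →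
              CoronaAdj G H x y → CoronaAdj G H y x
  coronaSym G H {inj₁ u} {inj₁ v} a = sym G a
  coronaSym G H {inj₁ u} {inj₂ _} e = ≡sym e
  coronaSym G H {inj₂ _} {inj₁ u} e = ≡sym e
  coronaSym G H {inj₂ _} {inj₂ _} (e , a) = ≡sym e , sym H a

  coronaIrrefl : ∀ {n m} (G : Graph (Fin n)) (H : Graph (Fin m)) {x} →
                 ¬ CoronaAdj G H x x
  coronaIrrefl G H {inj₁ u} a = irrefl G a
  coronaIrrefl G H {inj₂ _} (_ , a) = irrefl H a

_⊙_ : ∀ {n m} → Graph (Fin n) → Graph (Fin m) → Graph (CoronaV n m)
G ⊙ H = record { Adj = CoronaAdj G H ; sym = λ {x} {y} → coronaSym G H {x} {y} ; irrefl = λ {x} → coronaIrrefl G H {x} }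

-- A ∪ B as a vertex set of G ⊙ H, with A ⊆ V(G) and B given by its
-- traces B w ⊆ V(H_w) on each copy H_w.
unionAB : ∀ {n m} → Subset n → (Fin n → Subset m) → CoronaV n m → Set
unionAB A B (inj₁ v)       = v ∈ A
unionAB A B (inj₂ (w , h)) = h ∈ B w

{-# OPTIONS --safe #-}
module Submission where

-- The vertex a of G is a cut vertex of G ⊙ H separating the copy H_a from
-- the rest of the graph. Take h ∈ B in H_a; since |A| ≥ 2 there is some
-- a' ∈ A other than a, and every (h, a')-walk, shortest or not, passes
-- through a ∈ A. So h and a' are not (A ∪ B)-visible.

open import Defs
open import Data.Nat using (ℕ; _≤_)
open import Data.Nat.Properties using (<⇒≱)
open import Data.Fin using (Fin)
open import Data.Fin.Properties using (any?; _≟_)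
open import Data.Fin.Subset using (Subset; _∈_; _⊆_; ∣_∣; ⁅_⁆)
open import Data.Fin.Subset.Properties using (_∈?_; x∈⁅y⁆⇔x≡y; ∣⁅x⁆∣≡1; p⊆q⇒∣p∣≤∣q∣)
open import Data.Product using (∃; ∃₂; _×_; _,_)
open import Data.Sum using (inj₁; inj₂; [_,_]′)
open import Data.List.Membership.Propositional using () renaming (_∈_ to _∈ₗ_)
open import Data.List.Relation.Unary.Any using (here; there)
import Data.List.Relation.Unary.All as All
open import Function.Bundles using (Equivalence)
open import Relation.Nullary using (¬_)
open import Relation.Nullary.Decidable using (_×-dec_; ¬?; decidable-stable)
open import Relation.Binary.PropositionalEquality using (_≢_; refl; subst)

2≤∣p∣⇒∃y∈p-y≢x : ∀ {n} {p : Subset n} → 2 ≤ ∣ p ∣ → (x : Fin n) → ∃ λ y → y ∈ p × y ≢ x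
2≤∣p∣⇒∃y∈p-y≢x {p = p} 2≤∣p∣ x =
  decidable-stable (any? λ y → y ∈? p ×-dec ¬? (y ≟ x)) ¬¬∃
  where
  ¬¬∃ : ¬ ¬ ∃ λ y → y ∈ p × y ≢ x
  ¬¬∃ ∄ = <⇒≱ 2≤∣p∣ (subst (∣ p ∣ ≤_) (∣⁅x⁆∣≡1 x) (p⊆q⇒∣p∣≤∣q∣ p⊆⁅x⁆))
    where
    p⊆⁅x⁆ : p ⊆ ⁅ x ⁆
    p⊆⁅x⁆ {y} y∈p = Equivalence.from x∈⁅y⁆⇔x≡y
      (decidable-stable (y ≟ x) λ y≢x → ∄ (y , y∈p , y≢x))

module _ {V : Set} (G : Graph V) where

  start∈walkVertices : ∀ {u v k} (P : Walk G u v k) → u ∈ₗ walkVertices G P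
  start∈walkVertices []      = here refl
  start∈walkVertices (_ ∷ _) = here refl

  ¬Visible-through-separator : ∀ {X : V → Set} {u v w} → X w → w ≢ u → w ≢ v →
    (∀ {k} (P : Walk G u v k) → w ∈ₗ walkVertices G P) → ¬ Visible G X u v
  ¬Visible-through-separator Xw w≢u w≢v separates (_ , P , _ , avoids) =
    [ w≢u , w≢v ]′ (All.lookup avoids (separates P) Xw)

module _ {n m : ℕ} (G : Graph (Fin n)) (H : Graph (Fin m)) where

  walk-leaving-copy-visits-root : ∀ {w h v k} (P : Walk (G ⊙ H) (inj₂ (w , h)) (inj₁ v) k) →
    inj₁ w ∈ₗ walkVertices (G ⊙ H) P
  walk-leaving-copy-visits-root (_∷_ {w = inj₁ _} refl P)       = there (start∈walkVertices (G ⊙ H) P)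
  walk-leaving-copy-visits-root (_∷_ {w = inj₂ _} (refl , _) P) = there (walk-leaving-copy-visits-root P)

mainTheorem4 : (n m : ℕ) (G : Graph (Fin n)) (H : Graph (Fin m)) →
    Connected G → Connected H →
    (A : Subset n) → 2 ≤ ∣ A ∣ →
    (B : Fin n → Subset m) →
    (∃₂ λ a h → a ∈ A × h ∈ B a) →
    ¬ IsMutualVisibilitySet (G ⊙ H) (unionAB A B)
mainTheorem4 n m G H _ _ A 2≤∣A∣ B (a , h , a∈A , h∈Ba) isMV with 2≤∣p∣⇒∃y∈p-y≢x 2≤∣A∣ a
... | a' , a'∈A , a'≢a =
  ¬Visible-through-separator (G ⊙ H) a∈A (λ ()) (λ { refl → a'≢a refl })
    (walk-leaving-copy-visits-root G H) (isMV (inj₂ (a , h)) (inj₁ a') h∈Ba a'∈A)
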